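{- Let $m\ge0$ be an integer and let $s_n$ be defined by $s_n=\delta_{n,0}+s_{n-1}+s_{n-m-2}$ for $n\ge0$ and $s_n=0$ for $n<0$. Then for all $n\ge0$, \[ s_{n}^2=s_{n}+2\sum_{k=0}^{n-m-2}\sum_{r=m+2}^{n-k}P_{r-1}^{\{ -2,-1,m\}}s_{k}s_{n-k-r}^2 . \]
   Context: $\delta_{i,j}$ is $1$ if $i=j$ and $0$ otherwise; empty sums are $0$. For a finite set $W$ of integers, $P_n^W$ is the number of permutations $\pi$ of $\{1,\ldots,n\}$ with $\pi(i)-i\in W$ for all $i$ (equivalently, the permanent of the $n\times n$ $(0,1)$ matrix whose $(i,j)$ entry is $1$ iff $j-i\in W$), with $P_0^W=1$. -}

module Defs where

open import Data.Nat as ℕ using (ℕ; zero; suc)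
open import Data.Integer as ℤ using (ℤ; +_; -[1+_])
open import Data.List using (List; []; _∷_; map; concatMap; upTo; length; filter; zip; foldr)
open import Data.List.Relation.Unary.All using (All)
open import Data.List.Relation.Unary.All.Properties using ()
import Data.List.Relation.Unary.All as All
open import Data.List.Relation.Unary.Unique.Propositional using (Unique)
open import Data.List.Relation.Unary.Unique.DecPropositional ℕ._≟_ using (unique?)
open import Data.List.Membership.DecPropositional ℤ._≟_ using (_∈_; _∈?_)
open import Data.Product using (_×_; _,_; proj₁; proj₂)
open import Relation.Nullary.Decidable using (_×-dec_)
open import Relation.Nullary using (Dec; yes; no)

δ : ℕ → ℕ → ℤ
δ i j with i ℕ.≟ j
... | yes _ = + 1
... | no _ = + 0

seqs : ℕ → ℕ → List (List ℕ)
seqs zero    n = [] ∷ []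
seqs (suc k) n = concatMap (λ l → map (λ i → suc i ∷ l) (upTo n)) (seqs k n)

-- a list [π(1),…,π(n)] of length n with entries in {1,…,n} encodes a
-- permutation iff its entries are distinct; the window condition
-- π(i) - i ∈ W for all i = 1,…,n.
inWindow : List ℤ → List ℕ → Set
inWindow W π = All (λ p → (+ proj₂ p ℤ.- + proj₁ p) ∈ W) (zip (map suc (upTo (length π))) π)

inWindow? : (W : List ℤ) → (π : List ℕ) → Dec (inWindow W π)
inWindow? W π = All.all? (λ p → (+ proj₂ p ℤ.- + proj₁ p) ∈? W) (zip (map suc (upTo (length π))) π)

P : List ℤ → ℕ → ℕ
P W n = length (filter (λ π → unique? π ×-dec inWindow? W π) (seqs n n))

rangeLen : ℤ → ℤ → ℕ
rangeLen a b with b ℤ.- a ℤ.+ + 1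
... | + k = k
... | -[1+ _ ] = 0

Σ[_⋯_] : ℤ → ℤ → (ℤ → ℤ) → ℤ
Σ[ a ⋯ b ] f = foldr ℤ._+_ (+ 0) (map (λ i → f (a ℤ.+ + i)) (upTo (rangeLen a b)))

{-# OPTIONS --safe #-}
module Submission where

-- A permutation with π(i) − i ∈ {−2, −1, m} is built position by position: position q can only take the
-- values q − 2, q − 1 or q + m, and q − 2 must be used at once or never.  So the set of unused values has at
-- most two holes, and counting completions gives a small transfer recursion `walks` with P_r = walks 0 0 r.
-- From s_{L+1} = s_L + s_{L−m−1} one proves by induction the product formula
--   s_L s_{L−1−b} = Σ_t walks 0 b t · s_{L−1−t}²   (b ≤ m),
-- which for b = m collapses the inner sum over r to E_{n−k} = s_{n−k−1} s_{n−k−m−2}.  Finally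
-- 2 Σ_j E_j s_{n−j} = s_n² − s_n by induction along the recurrence: writing s_d = δ_{d,0} + y + z with
-- y = s_{d−1}, z = s_{d−m−2}, one has (y + z)² − (y + z) = 2yz + (y² − y) + (z² − z).

module Counting where

  open import Defs
  open import Data.Nat as ℕ using (ℕ; zero; suc; _+_; _*_; _∸_; _≤_; _<_; z≤n; s≤s)
  open import Data.Nat.Properties
  open import Data.Nat.Tactic.RingSolver using (solve-∀)
  open import Data.Integer as ℤ using (ℤ; _⊖_)
  import Data.Integer.Properties as ℤ
  open import Data.Bool using (true; false; if_then_else_; _∨_)
  open import Data.List using (List; []; _∷_; map; concatMap; upTo; length; filter; zip; applyUpTo; _++_)
  open import Data.List.Properties using (map-upTo; filter-accept; filter-reject; filter-all)
  open import Data.List.Relation.Unary.All as All using (All; []; _∷_)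
  open import Data.List.Relation.Unary.All.Properties using (filter⁺)
  open import Data.List.Relation.Unary.Unique.DecPropositional ℕ._≟_ using (unique?)
  open import Data.List.Membership.DecPropositional ℤ._≟_ using (_∈_; _∈?_)
  open import Data.Product using (_×_; _,_; proj₁; proj₂)
  open import Data.Sum as Sum using (_⊎_; inj₁; inj₂; [_,_]′)
  open import Data.Empty using (⊥-elim)
  open import Relation.Nullary using (Dec; yes; no; does; ¬_)
  open import Relation.Nullary.Decidable using (_×-dec_; ¬?)
  open import Relation.Binary.PropositionalEquality
  open import Function using (_∘_)

  𝟙 : ∀ {p} {A : Set p} → Dec A → ℕ
  𝟙 d = if does d then 1 else 0

  𝟙-× : ∀ {a b} {A : Set a} {B : Set b} (x : Dec A) (y : Dec B) → 𝟙 (x ×-dec y) ≡ 𝟙 x * 𝟙 y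
  𝟙-× (yes _) (yes _) = refl
  𝟙-× (yes _) (no _)  = refl
  𝟙-× (no _)  _       = refl

  𝟙-yes : ∀ {a} {A : Set a} (d : Dec A) → A → 𝟙 d ≡ 1
  𝟙-yes (yes _) _ = refl
  𝟙-yes (no ¬a) a = ⊥-elim (¬a a)

  𝟙-no : ∀ {a} {A : Set a} (d : Dec A) → ¬ A → 𝟙 d ≡ 0
  𝟙-no (yes a) ¬a = ⊥-elim (¬a a)
  𝟙-no (no _)  _  = refl

  one-* : ∀ {a b r} → a ≡ 1 → b ≡ r → a * b ≡ r
  one-* refl refl = +-identityʳ _

  does-⇔ : ∀ {a b} {A : Set a} {B : Set b} (x : Dec A) (y : Dec B) → (A → B) → (B → A) → does x ≡ does y
  does-⇔ (yes a) (yes b) f g = refl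
  does-⇔ (yes a) (no ¬b) f g = ⊥-elim (¬b (f a))
  does-⇔ (no ¬a) (yes b) f g = ⊥-elim (¬a (g b))
  does-⇔ (no ¬a) (no ¬b) f g = refl

  sumOver : ∀ {a} {A : Set a} → List A → (A → ℕ) → ℕ
  sumOver []       f = 0
  sumOver (x ∷ xs) f = f x + sumOver xs f

  module _ {a} {A : Set a} where

    sumOver-cong : (xs : List A) {f g : A → ℕ} → (∀ x → f x ≡ g x) → sumOver xs f ≡ sumOver xs g
    sumOver-cong []       e = refl
    sumOver-cong (x ∷ xs) e = cong₂ _+_ (e x) (sumOver-cong xs e)

    sumOver-zero : (xs : List A) → sumOver xs (λ _ → 0) ≡ 0
    sumOver-zero []       = refl
    sumOver-zero (x ∷ xs) = sumOver-zero xs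

    sumOver-+ : (xs : List A) (f g : A → ℕ) → sumOver xs (λ x → f x + g x) ≡ sumOver xs f + sumOver xs g
    sumOver-+ []       f g = refl
    sumOver-+ (x ∷ xs) f g rewrite sumOver-+ xs f g = interchange (f x) (g x) (sumOver xs f) (sumOver xs g)
      where
      interchange : ∀ a b c d → a + b + (c + d) ≡ a + c + (b + d)
      interchange = solve-∀

    sumOver-*ˡ : (xs : List A) (c : ℕ) (f : A → ℕ) → sumOver xs (λ x → c * f x) ≡ c * sumOver xs f
    sumOver-*ˡ []       c f = sym (*-zeroʳ c)
    sumOver-*ˡ (x ∷ xs) c f rewrite sumOver-*ˡ xs c f = sym (*-distribˡ-+ c (f x) (sumOver xs f))

    sumOver-++ : (xs ys : List A) (f : A → ℕ) → sumOver (xs ++ ys) f ≡ sumOver xs f + sumOver ys f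
    sumOver-++ []       ys f = refl
    sumOver-++ (x ∷ xs) ys f rewrite sumOver-++ xs ys f = sym (+-assoc (f x) _ _)

    sumOver-filter : ∀ {p} {P : A → Set p} (P? : ∀ x → Dec (P x)) (xs : List A) (f : A → ℕ) →
                     sumOver xs (λ x → 𝟙 (P? x) * f x) ≡ sumOver (filter P? xs) f
    sumOver-filter P? []       f = refl
    sumOver-filter P? (x ∷ xs) f with does (P? x)
    ... | true  = cong₂ _+_ (+-identityʳ (f x)) (sumOver-filter P? xs f)
    ... | false = sumOver-filter P? xs f

    length-filter≡sumOver-𝟙 : ∀ {p} {P : A → Set p} (P? : ∀ x → Dec (P x)) (xs : List A) →
                              length (filter P? xs) ≡ sumOver xs (𝟙 ∘ P?)
    length-filter≡sumOver-𝟙 P? []       = refl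
    length-filter≡sumOver-𝟙 P? (x ∷ xs) with does (P? x)
    ... | true  = cong suc (length-filter≡sumOver-𝟙 P? xs)
    ... | false = length-filter≡sumOver-𝟙 P? xs

  sumOver-map : ∀ {a b} {A : Set a} {B : Set b} (h : A → B) (xs : List A) (f : B → ℕ) →
                sumOver (map h xs) f ≡ sumOver xs (f ∘ h)
  sumOver-map h []       f = refl
  sumOver-map h (x ∷ xs) f = cong (f (h x) +_) (sumOver-map h xs f)

  sumOver-swap : ∀ {a b} {A : Set a} {B : Set b} (xs : List A) (ys : List B) (f : A → B → ℕ) →
                 sumOver xs (λ x → sumOver ys (f x)) ≡ sumOver ys (λ y → sumOver xs (λ x → f x y))
  sumOver-swap []       ys f = sym (sumOver-zero ys)
  sumOver-swap (x ∷ xs) ys f rewrite sumOver-swap xs ys f = sym (sumOver-+ ys (f x) (λ y → sumOver xs (λ x → f x y)))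

  sumOver-concatMap : ∀ {a b} {A : Set a} {B : Set b} (F : A → List B) (xs : List A) (g : B → ℕ) →
                      sumOver (concatMap F xs) g ≡ sumOver xs (λ x → sumOver (F x) g)
  sumOver-concatMap F []       g = refl
  sumOver-concatMap F (x ∷ xs) g =
    trans (sumOver-++ (F x) (concatMap F xs) g) (cong (sumOver (F x) g +_) (sumOver-concatMap F xs g))

  sumTuples : ∀ {a} {A : Set a} → ℕ → List A → (List A → ℕ) → ℕ
  sumTuples zero    U g = g []
  sumTuples (suc k) U g = sumTuples k U (λ l → sumOver U (λ x → g (x ∷ l)))

  module _ {a} {A : Set a} where

    sumTuples-cong : ∀ k (U : List A) {f g : List A → ℕ} → (∀ l → f l ≡ g l) → sumTuples k U f ≡ sumTuples k U g
    sumTuples-cong zero    U e = e []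
    sumTuples-cong (suc k) U e = sumTuples-cong k U (λ l → sumOver-cong U (λ x → e (x ∷ l)))

    sumTuples-sumOver : ∀ {b} {B : Set b} k (U : List A) (V : List B) (h : B → List A → ℕ) →
                        sumTuples k U (λ l → sumOver V (λ y → h y l)) ≡ sumOver V (λ y → sumTuples k U (h y))
    sumTuples-sumOver zero    U V h = refl
    sumTuples-sumOver (suc k) U V h =
      trans (sumTuples-cong k U (λ l → sumOver-swap U V (λ x y → h y (x ∷ l))))
            (sumTuples-sumOver k U V (λ y l → sumOver U (λ x → h y (x ∷ l))))

    sumTuples-*ˡ : ∀ k (U : List A) c (g : List A → ℕ) → sumTuples k U (λ l → c * g l) ≡ c * sumTuples k U g
    sumTuples-*ˡ zero    U c g = refl
    sumTuples-*ˡ (suc k) U c g = trans (sumTuples-cong k U (λ l → sumOver-*ˡ U c (λ x → g (x ∷ l)))) (sumTuples-*ˡ k U c _)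

  range : ℕ → ℕ → List ℕ
  range lo zero    = []
  range lo (suc n) = lo ∷ range (suc lo) n

  applyUpTo≡range : ∀ (f : ℕ → ℕ) lo n → (∀ j → f j ≡ lo + j) → applyUpTo f n ≡ range lo n
  applyUpTo≡range f lo zero    e = refl
  applyUpTo≡range f lo (suc n) e =
    cong₂ _∷_ (trans (e 0) (+-identityʳ lo)) (applyUpTo≡range (f ∘ suc) (suc lo) n (λ j → trans (e (suc j)) (+-suc lo j)))

  map-suc-upTo : ∀ n → map suc (upTo n) ≡ range 1 n
  map-suc-upTo n = trans (map-upTo suc n) (applyUpTo≡range suc 1 n (λ _ → refl))

  sumOver-seqs : ∀ k n (g : List ℕ → ℕ) → sumOver (seqs k n) g ≡ sumTuples k (range 1 n) g
  sumOver-seqs zero    n g = +-identityʳ (g [])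
  sumOver-seqs (suc k) n g = begin
    sumOver (seqs (suc k) n) g
      ≡⟨ sumOver-concatMap (λ l → map (λ i → suc i ∷ l) (upTo n)) (seqs k n) g ⟩
    sumOver (seqs k n) (λ l → sumOver (map (λ i → suc i ∷ l) (upTo n)) g)
      ≡⟨ sumOver-cong (seqs k n) (λ l → trans (sumOver-map (λ i → suc i ∷ l) (upTo n) g)
           (trans (sym (sumOver-map suc (upTo n) (λ x → g (x ∷ l))))
                  (cong (λ U → sumOver U (λ x → g (x ∷ l))) (map-suc-upTo n)))) ⟩
    sumOver (seqs k n) (λ l → sumOver (range 1 n) (λ x → g (x ∷ l)))
      ≡⟨ sumOver-seqs k n _ ⟩
    sumTuples (suc k) (range 1 n) g ∎
    where open ≡-Reasoning

  _≢?_ : (x y : ℕ) → Dec (¬ x ≡ y)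
  x ≢? y = ¬? (x ℕ.≟ y)

  infixl 6 _∖_
  _∖_ : List ℕ → ℕ → List ℕ
  U ∖ x = filter (x ≢?_) U

  sumTuples-fresh : ∀ k U x (g : List ℕ → ℕ) →
                    sumTuples k U (λ l → 𝟙 (All.all? (x ≢?_) l) * g l) ≡ sumTuples k (U ∖ x) g
  sumTuples-fresh zero    U x g = +-identityʳ (g [])
  sumTuples-fresh (suc k) U x g = begin
    sumTuples k U (λ l → sumOver U (λ y → fresh (y ∷ l) * g (y ∷ l)))
      ≡⟨ sumTuples-cong k U (λ l → trans (sumOver-cong U (split l)) (sumOver-*ˡ U (fresh l) _)) ⟩
    sumTuples k U (λ l → fresh l * sumOver U (λ y → 𝟙 (x ≢? y) * g (y ∷ l)))
      ≡⟨ sumTuples-fresh k U x _ ⟩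
    sumTuples k (U ∖ x) (λ l → sumOver U (λ y → 𝟙 (x ≢? y) * g (y ∷ l)))
      ≡⟨ sumTuples-cong k _ (λ l → sumOver-filter (x ≢?_) U (λ y → g (y ∷ l))) ⟩
    sumTuples (suc k) (U ∖ x) g ∎
    where
    open ≡-Reasoning
    fresh : List ℕ → ℕ
    fresh l = 𝟙 (All.all? (x ≢?_) l)
    split : ∀ l y → fresh (y ∷ l) * g (y ∷ l) ≡ fresh l * (𝟙 (x ≢? y) * g (y ∷ l))
    split l y rewrite 𝟙-× (x ≢? y) (All.all? (x ≢?_) l) = rearrange (𝟙 (x ≢? y)) (fresh l) (g (y ∷ l))
      where
      rearrange : ∀ a b c → a * b * c ≡ b * (a * c)
      rearrange = solve-∀

  module Window (W : List ℤ) where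

    offset∈W? : (p : ℕ × ℕ) → Dec ((ℤ.+ proj₂ p ℤ.- ℤ.+ proj₁ p) ∈ W)
    offset∈W? p = (ℤ.+ proj₂ p ℤ.- ℤ.+ proj₁ p) ∈? W

    weight : ℕ → ℕ → ℕ
    weight q x = 𝟙 (offset∈W? (q , x))

    windowCount : ℕ → List ℕ → ℕ → ℕ
    windowCount zero    U q = 1
    windowCount (suc k) U q = sumOver U (λ x → weight q x * windowCount k (U ∖ x) (suc q))

    fitsWindow : ℕ → List ℕ → ℕ
    fitsWindow q l = 𝟙 (All.all? offset∈W? (zip (range q (length l)) l))

    sumTuples≡windowCount : ∀ k U q → sumTuples k U (λ l → 𝟙 (unique? l) * fitsWindow q l) ≡ windowCount k U q
    sumTuples≡windowCount zero    U q = refl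
    sumTuples≡windowCount (suc k) U q = begin
      sumTuples k U (λ l → sumOver U (λ x → 𝟙 (unique? (x ∷ l)) * fitsWindow q (x ∷ l)))
        ≡⟨ sumTuples-cong k U (λ l → sumOver-cong U (split l)) ⟩
      sumTuples k U (λ l → sumOver U (λ x → weight q x * (𝟙 (All.all? (x ≢?_) l) * rest l)))
        ≡⟨ sumTuples-sumOver k U U (λ x l → weight q x * (𝟙 (All.all? (x ≢?_) l) * rest l)) ⟩
      sumOver U (λ x → sumTuples k U (λ l → weight q x * (𝟙 (All.all? (x ≢?_) l) * rest l)))
        ≡⟨ sumOver-cong U (λ x → trans (sumTuples-*ˡ k U (weight q x) _)
                                       (cong (weight q x *_) (sumTuples-fresh k U x rest))) ⟩
      sumOver U (λ x → weight q x * sumTuples k (U ∖ x) rest)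
        ≡⟨ sumOver-cong U (λ x → cong (weight q x *_) (sumTuples≡windowCount k (U ∖ x) (suc q))) ⟩
      windowCount (suc k) U q ∎
      where
      open ≡-Reasoning
      rest : List ℕ → ℕ
      rest l = 𝟙 (unique? l) * fitsWindow (suc q) l
      split : ∀ l x → 𝟙 (unique? (x ∷ l)) * fitsWindow q (x ∷ l) ≡ weight q x * (𝟙 (All.all? (x ≢?_) l) * rest l)
      split l x rewrite 𝟙-× (All.all? (x ≢?_) l) (unique? l)
                      | 𝟙-× (offset∈W? (q , x)) (All.all? offset∈W? (zip (range (suc q) (length l)) l)) =
        rearrange (𝟙 (All.all? (x ≢?_) l)) (𝟙 (unique? l)) (weight q x) (fitsWindow (suc q) l)
        where
        rearrange : ∀ a b c d → a * b * (c * d) ≡ c * (a * (b * d))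
        rearrange = solve-∀

    P≡windowCount : ∀ n → P W n ≡ windowCount n (range 1 n) 1
    P≡windowCount n = begin
      P W n
        ≡⟨ length-filter≡sumOver-𝟙 (λ π → unique? π ×-dec inWindow? W π) (seqs n n) ⟩
      sumOver (seqs n n) (λ π → 𝟙 (unique? π ×-dec inWindow? W π))
        ≡⟨ sumOver-seqs n n _ ⟩
      sumTuples n (range 1 n) (λ π → 𝟙 (unique? π ×-dec inWindow? W π))
        ≡⟨ sumTuples-cong n _ (λ π → trans (𝟙-× (unique? π) (inWindow? W π))
                                           (cong (λ ps → 𝟙 (unique? π) * 𝟙 (All.all? offset∈W? (zip ps π)))
                                                 (map-suc-upTo (length π)))) ⟩
      sumTuples n (range 1 n) (λ π → 𝟙 (unique? π) * fitsWindow 1 π)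
        ≡⟨ sumTuples≡windowCount n _ 1 ⟩
      windowCount n (range 1 n) 1 ∎
      where open ≡-Reasoning

  ∖-head : ∀ x U → (x ∷ U) ∖ x ≡ U ∖ x
  ∖-head x U = filter-reject (x ≢?_) (λ x≢x → x≢x refl)

  ∖-other : ∀ {x y} U → ¬ x ≡ y → (y ∷ U) ∖ x ≡ y ∷ U ∖ x
  ∖-other U x≢y = filter-accept (_ ≢?_) x≢y

  ∖-comm : ∀ a b U → U ∖ b ∖ a ≡ U ∖ a ∖ b
  ∖-comm a b []      = refl
  ∖-comm a b (x ∷ U) with a ℕ.≟ x | b ℕ.≟ x
  ... | yes refl | yes refl = refl
  ... | yes refl | no b≢a rewrite ∖-other {b} U b≢a | ∖-head a (U ∖ b) | ∖-head a U = ∖-comm a b U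
  ... | no a≢b | yes refl rewrite ∖-other {a} U a≢b | ∖-head b (U ∖ a) | ∖-head b U = ∖-comm a b U
  ... | no a≢x | no b≢x rewrite ∖-other {b} U b≢x | ∖-other {a} U a≢x
                              | ∖-other {a} (U ∖ b) a≢x | ∖-other {b} (U ∖ a) b≢x = cong (x ∷_) (∖-comm a b U)

  range-lower : ∀ lo n → All (lo ≤_) (range lo n)
  range-lower lo zero    = []
  range-lower lo (suc n) = ≤-refl ∷ All.map (≤-trans (n≤1+n lo)) (range-lower (suc lo) n)

  range-∖-head : ∀ lo n → range lo (suc n) ∖ lo ≡ range (suc lo) n
  range-∖-head lo n = trans (∖-head lo (range (suc lo) n))
                            (filter-all (lo ≢?_) (All.map (λ lo<x → <⇒≢ lo<x) (range-lower (suc lo) n)))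

  length-range : ∀ lo n → length (range lo n) ≡ n
  length-range lo zero    = refl
  length-range lo (suc n) = cong suc (length-range (suc lo) n)

  multiplicity : ℕ → List ℕ → ℕ
  multiplicity v U = sumOver U (λ x → 𝟙 (x ℕ.≟ v))

  sumOver-pick : ∀ U v (f : ℕ → ℕ) → sumOver U (λ x → 𝟙 (x ℕ.≟ v) * f x) ≡ multiplicity v U * f v
  sumOver-pick []      v f = refl
  sumOver-pick (x ∷ U) v f with x ℕ.≟ v
  ... | yes refl rewrite 𝟙-yes (x ℕ.≟ x) refl | sumOver-pick U x f = cong (_+ multiplicity x U * f x) (+-identityʳ (f x))
  ... | no x≢v rewrite 𝟙-no (x ℕ.≟ v) x≢v = sumOver-pick U v f

  sumOver-All-zero : ∀ {p} {P : ℕ → Set p} U (f : ℕ → ℕ) → All P U → (∀ x → P x → f x ≡ 0) → sumOver U f ≡ 0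
  sumOver-All-zero []      f []         h = refl
  sumOver-All-zero (x ∷ U) f (px ∷ pU) h rewrite h x px = sumOver-All-zero U f pU h

  sumOver-members-zero : ∀ U (f : ℕ → ℕ) → (∀ x → 1 ≤ multiplicity x U → f x ≡ 0) → sumOver U f ≡ 0
  sumOver-members-zero []      f h = refl
  sumOver-members-zero (y ∷ U) f h =
    cong₂ _+_ (h y y∈) (sumOver-members-zero U f (λ x x∈ → h x (≤-trans x∈ (m≤n+m _ _))))
    where
    y∈ : 1 ≤ multiplicity y (y ∷ U)
    y∈ rewrite 𝟙-yes (y ℕ.≟ y) refl = s≤s z≤n

  multiplicity-∖ : ∀ v d U → ¬ v ≡ d → multiplicity v (U ∖ d) ≡ multiplicity v U
  multiplicity-∖ v d []      v≢d = refl
  multiplicity-∖ v d (x ∷ U) v≢d with d ℕ.≟ x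
  ... | yes refl rewrite ∖-head d U | 𝟙-no (d ℕ.≟ v) (v≢d ∘ sym) = multiplicity-∖ v d U v≢d
  ... | no d≢x   rewrite ∖-other U d≢x = cong (𝟙 (x ℕ.≟ v) +_) (multiplicity-∖ v d U v≢d)

  length-∖ : ∀ d U → length (U ∖ d) + multiplicity d U ≡ length U
  length-∖ d []      = refl
  length-∖ d (x ∷ U) with d ℕ.≟ x
  ... | yes refl rewrite ∖-head d U | 𝟙-yes (d ℕ.≟ d) refl = trans (+-suc _ _) (cong suc (length-∖ d U))
  ... | no d≢x   rewrite ∖-other U d≢x | 𝟙-no (x ℕ.≟ d) (d≢x ∘ sym) = cong suc (length-∖ d U)

  multiplicity-range-out : ∀ lo n v → v < lo ⊎ lo + n ≤ v → multiplicity v (range lo n) ≡ 0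
  multiplicity-range-out lo zero    v out = refl
  multiplicity-range-out lo (suc n) v out with lo ℕ.≟ v
  ... | yes refl = ⊥-elim ([ <-irrefl refl , (λ le → <-irrefl refl (≤-trans (m<m+n lo (s≤s z≤n)) le)) ]′ out)
  ... | no lo≢v rewrite 𝟙-no (lo ℕ.≟ v) lo≢v =
    multiplicity-range-out (suc lo) n v
      (Sum.map (λ v<lo → ≤-trans v<lo (n≤1+n _)) (≤-trans (≤-reflexive (sym (+-suc lo n)))) out)

  multiplicity-range-in : ∀ lo n v → lo ≤ v → v < lo + n → multiplicity v (range lo n) ≡ 1
  multiplicity-range-in lo zero    v lo≤v v<lo =
    ⊥-elim (<-irrefl refl (≤-trans v<lo (≤-trans (≤-reflexive (+-identityʳ lo)) lo≤v)))
  multiplicity-range-in lo (suc n) v lo≤v v<lo+n with lo ℕ.≟ v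
  ... | yes refl rewrite 𝟙-yes (lo ℕ.≟ lo) refl = cong suc (multiplicity-range-out (suc lo) n lo (inj₁ ≤-refl))
  ... | no lo≢v  rewrite 𝟙-no (lo ℕ.≟ v) lo≢v =
    multiplicity-range-in (suc lo) n v (≤∧≢⇒< lo≤v lo≢v) (≤-trans v<lo+n (≤-reflexive (+-suc lo n)))

  m⊖[1+d+m]≡-[1+d] : ∀ x d → x ⊖ (suc d + x) ≡ ℤ.-[1+ d ]
  m⊖[1+d+m]≡-[1+d] x d = trans (cong (_⊖ (suc d + x)) (sym (+-identityʳ x)))
                          (trans (cong ((x + 0) ⊖_) (+-comm (suc d) x)) (ℤ.+-cancelˡ-⊖ x 0 (suc d)))

  m⊖n≡-[1+d]⇒n≡1+d+m : ∀ x q d → x ⊖ q ≡ ℤ.-[1+ d ] → q ≡ suc d + x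
  m⊖n≡-[1+d]⇒n≡1+d+m x q d e with q ℕ.≤? x
  ... | yes q≤x with () ← trans (sym (ℤ.⊖-≥ q≤x)) e
  ... | no q≰x with q ∸ x in eq | trans (sym (ℤ.⊖-≰ q≰x)) e
  ...   | suc _ | refl = trans (sym (m∸n+n≡m (≰⇒≥ q≰x))) (cong (_+ x) eq)

  [n+d]⊖n≡+d : ∀ q d → (q + d) ⊖ q ≡ ℤ.+ d
  [n+d]⊖n≡+d q d = trans (ℤ.⊖-≥ (m≤m+n q d)) (cong ℤ.+_ (m+n∸m≡n q d))

  m⊖n≡+d⇒m≡n+d : ∀ x q d → x ⊖ q ≡ ℤ.+ d → x ≡ q + d
  m⊖n≡+d⇒m≡n+d x q d e with q ℕ.≤? x
  ... | yes q≤x = trans (sym (m+[n∸m]≡n q≤x)) (cong (q +_) (ℤ.+-injective (trans (sym (ℤ.⊖-≥ q≤x)) e)))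
  ... | no q≰x with q ∸ x in eq | trans (sym (ℤ.⊖-≰ q≰x)) e
  ...   | zero | _ = ⊥-elim (q≰x (m∸n≡0⇒m≤n eq))

  𝟙-disjoint-∨ : ∀ {a b c} {A : Set a} {B : Set b} {C : Set c} (x : Dec A) (y : Dec B) (z : Dec C) →
                 (A → ¬ B) → (A → ¬ C) → (B → ¬ C) →
                 (if does x ∨ (does y ∨ (does z ∨ false)) then 1 else 0) ≡ 𝟙 x + 𝟙 y + 𝟙 z
  𝟙-disjoint-∨ (yes a) (yes b) _       a#b a#c b#c = ⊥-elim (a#b a b)
  𝟙-disjoint-∨ (yes a) (no _)  (yes c) a#b a#c b#c = ⊥-elim (a#c a c)
  𝟙-disjoint-∨ (yes _) (no _)  (no _)  a#b a#c b#c = refl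
  𝟙-disjoint-∨ (no _)  (yes b) (yes c) a#b a#c b#c = ⊥-elim (b#c b c)
  𝟙-disjoint-∨ (no _)  (yes _) (no _)  a#b a#c b#c = refl
  𝟙-disjoint-∨ (no _)  (no _)  (yes _) a#b a#c b#c = refl
  𝟙-disjoint-∨ (no _)  (no _)  (no _)  a#b a#c b#c = refl

  module ThreeWindow (m : ℕ) where

    W : List ℤ
    W = ℤ.-[1+ 1 ] ∷ ℤ.-[1+ 0 ] ∷ ℤ.+ m ∷ []

    open Window W public

    weight≡ : ∀ q x → weight q x ≡ 𝟙 (suc (suc x) ℕ.≟ q) + 𝟙 (suc x ℕ.≟ q) + 𝟙 (x ℕ.≟ q + m)
    weight≡ q x = trans (cong₂ (λ a bc → if a ∨ bc then 1 else 0) at-2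
                               (cong₂ (λ b c → b ∨ (c ∨ false)) at-1 at+m))
                        (𝟙-disjoint-∨ (suc (suc x) ℕ.≟ q) (suc x ℕ.≟ q) (x ℕ.≟ q + m)
                          (λ e₂ e₁ → 1+n≢n (trans e₂ (sym e₁)))
                          (λ e₂ eₘ → <-irrefl (sym (trans (cong (suc ∘ suc) (sym eₘ)) e₂))
                                             (≤-trans (s≤s (m≤m+n q m)) (n≤1+n _)))
                          (λ e₁ eₘ → <-irrefl (sym (trans (cong suc (sym eₘ)) e₁)) (s≤s (m≤m+n q m))))
      where
      z : ℤ
      z = ℤ.+ x ℤ.- ℤ.+ q
      z≡ : z ≡ x ⊖ q
      z≡ = ℤ.[+m]-[+n]≡m⊖n x q
      at-2 : does (z ℤ.≟ ℤ.-[1+ 1 ]) ≡ does (suc (suc x) ℕ.≟ q)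
      at-2 = does-⇔ (z ℤ.≟ ℤ.-[1+ 1 ]) (suc (suc x) ℕ.≟ q)
                    (λ e → sym (m⊖n≡-[1+d]⇒n≡1+d+m x q 1 (trans (sym z≡) e)))
                    (λ { refl → trans z≡ (m⊖[1+d+m]≡-[1+d] x 1) })
      at-1 : does (z ℤ.≟ ℤ.-[1+ 0 ]) ≡ does (suc x ℕ.≟ q)
      at-1 = does-⇔ (z ℤ.≟ ℤ.-[1+ 0 ]) (suc x ℕ.≟ q)
                    (λ e → sym (m⊖n≡-[1+d]⇒n≡1+d+m x q 0 (trans (sym z≡) e)))
                    (λ { refl → trans z≡ (m⊖[1+d+m]≡-[1+d] x 0) })
      at+m : does (z ℤ.≟ ℤ.+ m) ≡ does (x ℕ.≟ q + m)
      at+m = does-⇔ (z ℤ.≟ ℤ.+ m) (x ℕ.≟ q + m)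
                    (λ e → m⊖n≡+d⇒m≡n+d x q m (trans (sym z≡) e))
                    (λ { refl → trans z≡ ([n+d]⊖n≡+d q m) })

    windowCount-split : ∀ k U q → windowCount (suc k) U q ≡
        sumOver U (λ x → 𝟙 (suc (suc x) ℕ.≟ q) * windowCount k (U ∖ x) (suc q))
      + sumOver U (λ x → 𝟙 (suc x ℕ.≟ q) * windowCount k (U ∖ x) (suc q))
      + multiplicity (q + m) U * windowCount k (U ∖ (q + m)) (suc q)
    windowCount-split k U q = begin
      sumOver U (λ x → weight q x * R x)
        ≡⟨ sumOver-cong U (λ x → trans (cong (_* R x) (weight≡ q x))
                                       (*-distribʳ-+₃ (𝟙 (suc (suc x) ℕ.≟ q)) (𝟙 (suc x ℕ.≟ q)) (𝟙 (x ℕ.≟ q + m)) (R x))) ⟩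
      sumOver U (λ x → at-2 x + at-1 x + at+m x)
        ≡⟨ sumOver-+ U (λ x → at-2 x + at-1 x) at+m ⟩
      sumOver U (λ x → at-2 x + at-1 x) + sumOver U at+m
        ≡⟨ cong₂ _+_ (sumOver-+ U at-2 at-1) (sumOver-pick U (q + m) R) ⟩
      sumOver U at-2 + sumOver U at-1 + multiplicity (q + m) U * R (q + m) ∎
      where
      open ≡-Reasoning
      R at-2 at-1 at+m : ℕ → ℕ
      R x = windowCount k (U ∖ x) (suc q)
      at-2 x = 𝟙 (suc (suc x) ℕ.≟ q) * R x
      at-1 x = 𝟙 (suc x ℕ.≟ q) * R x
      at+m x = 𝟙 (x ℕ.≟ q + m) * R x
      *-distribʳ-+₃ : ∀ a b c r → (a + b + c) * r ≡ a * r + b * r + c * r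
      *-distribʳ-+₃ = solve-∀

    windowCount-split-above : ∀ k U i → All (i ≤_) U → windowCount (suc k) U (suc i) ≡
        multiplicity i U * windowCount k (U ∖ i) (suc (suc i))
      + multiplicity (suc i + m) U * windowCount k (U ∖ (suc i + m)) (suc (suc i))
    windowCount-split-above k U i i≤U =
      trans (windowCount-split k U (suc i))
            (cong (_+ multiplicity (suc i + m) U * R (suc i + m)) (cong₂ _+_ too-low (sumOver-pick U i R)))
      where
      R : ℕ → ℕ
      R x = windowCount k (U ∖ x) (suc (suc i))
      too-low : sumOver U (λ x → 𝟙 (suc x ℕ.≟ i) * R x) ≡ 0
      too-low = sumOver-All-zero U _ i≤U
                  (λ x i≤x → cong (_* R x) (𝟙-no (suc x ℕ.≟ i) (λ e → <-irrefl (sym e) (s≤s i≤x))))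

    windowCount-split-2+ : ∀ k U j → windowCount (suc k) U (suc (suc j)) ≡
        multiplicity j U * windowCount k (U ∖ j) (suc (suc (suc j)))
      + multiplicity (suc j) U * windowCount k (U ∖ suc j) (suc (suc (suc j)))
      + multiplicity (suc (suc j) + m) U * windowCount k (U ∖ (suc (suc j) + m)) (suc (suc (suc j)))
    windowCount-split-2+ k U j =
      trans (windowCount-split k U (suc (suc j)))
            (cong (_+ multiplicity (suc (suc j) + m) U * R (suc (suc j) + m))
                  (cong₂ _+_ (sumOver-pick U j R) (sumOver-pick U (suc j) R)))
      where
      R : ℕ → ℕ
      R x = windowCount k (U ∖ x) (suc (suc (suc j)))

    weight-below : ∀ q v → suc (suc v) < q → weight q v ≡ 0
    weight-below q v v+2<q rewrite weight≡ q v
      | 𝟙-no (suc (suc v) ℕ.≟ q) (λ e → <-irrefl e v+2<q)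
      | 𝟙-no (suc v ℕ.≟ q) (λ e → <-irrefl e (≤-trans (n≤1+n _) v+2<q))
      | 𝟙-no (v ℕ.≟ q + m) (λ e → <⇒≱ (≤-trans (≤-trans (n≤1+n _) (n≤1+n _)) v+2<q)
                                        (subst (q ≤_) (sym e) (m≤m+n q m))) = refl

    length-∖-member : ∀ k x U → 1 ≤ multiplicity x U → length U ≤ suc k → length (U ∖ x) ≤ k
    length-∖-member k x U x∈U ∣U∣≤1+k = ≤-pred (begin
      suc (length (U ∖ x))            ≡⟨ +-comm 1 _ ⟩
      length (U ∖ x) + 1              ≤⟨ +-monoʳ-≤ (length (U ∖ x)) x∈U ⟩
      length (U ∖ x) + multiplicity x U ≡⟨ length-∖ x U ⟩
      length U                        ≤⟨ ∣U∣≤1+k ⟩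
      suc k                           ∎)
      where open ≤-Reasoning

    -- positions only increase, so a value v with v + 2 < q can never be placed
    windowCount-stranded : ∀ k U q v → 1 ≤ multiplicity v U → suc (suc v) < q → length U ≤ k → windowCount k U q ≡ 0
    windowCount-stranded zero    []      q v () _ _
    windowCount-stranded zero    (_ ∷ _) q v _  _ ()
    windowCount-stranded (suc k) U q v v∈U v+2<q ∣U∣≤k = sumOver-members-zero U _ term
      where
      term : ∀ x → 1 ≤ multiplicity x U → weight q x * windowCount k (U ∖ x) (suc q) ≡ 0
      term x x∈U with x ℕ.≟ v
      ... | yes refl = cong (_* windowCount k (U ∖ x) (suc q)) (weight-below q x v+2<q)
      ... | no x≢v   = trans (cong (weight q x *_) (windowCount-stranded k (U ∖ x) (suc q) v
                               (≤-trans v∈U (≤-reflexive (sym (multiplicity-∖ v x U (x≢v ∘ sym)))))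
                               (≤-trans v+2<q (n≤1+n q)) (length-∖-member k x U x∈U ∣U∣≤k)))
                             (*-zeroʳ (weight q x))

    stranded-term : ∀ k U q v x → 1 ≤ multiplicity v U → ¬ v ≡ x → suc (suc v) < suc q → length U ≤ suc k →
                    multiplicity x U * windowCount k (U ∖ x) (suc q) ≡ 0
    stranded-term k U q v x v∈U v≢x v+2<q ∣U∣≤1+k with multiplicity x U in mult-x
    ... | zero  = refl
    ... | suc n = trans (cong (suc n *_) (windowCount-stranded k (U ∖ x) (suc q) v
                          (≤-trans v∈U (≤-reflexive (sym (multiplicity-∖ v x U v≢x)))) v+2<q
                          (length-∖-member k x U (≤-trans (s≤s z≤n) (≤-reflexive (sym mult-x))) ∣U∣≤1+k)))
                        (*-zeroʳ (suc n))

    -- the completions counted in windowCount-oneHole (c = 0) and windowCount-twoHoles (c > 0)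
    walks : ℕ → ℕ → ℕ → ℕ
    walks zero    zero    zero    = 1
    walks zero    (suc b) zero    = 0
    walks (suc c) b       zero    = 0
    walks (suc c) b       (suc t) = walks c b t
    walks zero    zero    (suc t) = walks zero m t
    walks zero    (suc b) (suc t) = walks zero b t + walks (suc b) (m ∸ suc b) t

    walks-zero : ∀ c b t → t < c + b → walks c b t ≡ 0
    walks-zero zero    zero    zero    ()
    walks-zero zero    (suc b) zero    _ = refl
    walks-zero (suc c) b       zero    _ = refl
    walks-zero (suc c) b       (suc t) (s≤s t<c+b) = walks-zero c b t t<c+b
    walks-zero zero    zero    (suc t) ()
    walks-zero zero    (suc b) (suc t) (s≤s t<b) =
      cong₂ _+_ (walks-zero zero b t t<b) (walks-zero (suc b) (m ∸ suc b) t (≤-trans (≤-trans t<b (m≤m+n b _)) (n≤1+n _)))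

    walks-shift : ∀ c b t → walks c b (c + t) ≡ walks 0 b t
    walks-shift zero    b t = refl
    walks-shift (suc c) b t = walks-shift c b t

    windowCount-oneHole : ∀ k i b → b ≤ m → b ≤ k →
      windowCount k (range i (suc k) ∖ (b + i)) (suc i) ≡ walks 0 b k
    windowCount-twoHoles : ∀ k j c b → suc c + b ≤ k → suc c + b ≤ m →
      windowCount k (range j (suc (suc k)) ∖ (suc c + j) ∖ suc (b + (suc c + j))) (suc (suc j)) ≡ walks (suc c) b k

    windowCount-oneHole zero    i zero    _ _ = refl
    windowCount-oneHole (suc k) i zero    _ _ = begin
      windowCount (suc k) (range i (suc (suc k)) ∖ i) (suc i)
        ≡⟨ cong (λ V → windowCount (suc k) V (suc i)) (range-∖-head i (suc k)) ⟩
      windowCount (suc k) V (suc i)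
        ≡⟨ windowCount-split-above k V i (All.map (≤-trans (n≤1+n i)) (range-lower (suc i) (suc k))) ⟩
      multiplicity i V * windowCount k (V ∖ i) (suc (suc i)) + jump
        ≡⟨ cong (λ a → a * windowCount k (V ∖ i) (suc (suc i)) + jump)
                (multiplicity-range-out (suc i) (suc k) i (inj₁ ≤-refl)) ⟩
      jump
        ≡⟨ jump≡ (m ℕ.≤? k) ⟩
      walks 0 m k ∎
      where
      open ≡-Reasoning
      V : List ℕ
      V = range (suc i) (suc k)
      jump : ℕ
      jump = multiplicity (suc i + m) V * windowCount k (V ∖ (suc i + m)) (suc (suc i))
      jump≡ : Dec (m ≤ k) → jump ≡ walks 0 m k
      jump≡ (yes m≤k) =
        one-* (multiplicity-range-in (suc i) (suc k) (suc i + m) (m≤m+n (suc i) m) (+-monoʳ-< (suc i) (s≤s m≤k)))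
              (trans (cong (λ v → windowCount k (V ∖ v) (suc (suc i))) (+-comm (suc i) m))
                     (windowCount-oneHole k (suc i) m ≤-refl m≤k))
      jump≡ (no m≰k) =
        trans (cong (_* windowCount k (V ∖ (suc i + m)) (suc (suc i)))
                    (multiplicity-range-out (suc i) (suc k) (suc i + m) (inj₂ (+-monoʳ-≤ (suc i) (≰⇒> m≰k)))))
              (sym (walks-zero 0 m k (≰⇒> m≰k)))
    windowCount-oneHole (suc k) i (suc b) b<m b<k = begin
      windowCount (suc k) U (suc i)
        ≡⟨ windowCount-split-above k U i (filter⁺ (suc (b + i) ≢?_) (range-lower i (suc (suc k)))) ⟩
      multiplicity i U * windowCount k (U ∖ i) (suc (suc i)) + jump
        ≡⟨ cong₂ _+_ stay (jump≡ (m ℕ.≤? k)) ⟩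
      walks 0 (suc b) (suc k) ∎
      where
      open ≡-Reasoning
      R U : List ℕ
      R = range i (suc (suc k))
      U = R ∖ suc (b + i)
      jump : ℕ
      jump = multiplicity (suc i + m) U * windowCount k (U ∖ (suc i + m)) (suc (suc i))
      i≢hole : ¬ i ≡ suc (b + i)
      i≢hole e = <-irrefl e (s≤s (m≤n+m i b))
      stay : multiplicity i U * windowCount k (U ∖ i) (suc (suc i)) ≡ walks 0 b k
      stay = one-* (trans (multiplicity-∖ i (suc (b + i)) R i≢hole)
                          (multiplicity-range-in i (suc (suc k)) i ≤-refl (m<m+n i (s≤s z≤n))))
                   (trans (cong (λ V → windowCount k V (suc (suc i))) U∖i)
                          (windowCount-oneHole k (suc i) b (≤-trans (n≤1+n b) b<m) (≤-pred b<k)))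
        where
        U∖i : U ∖ i ≡ range (suc i) (suc k) ∖ (b + suc i)
        U∖i = trans (∖-comm i (suc (b + i)) R)
                    (trans (cong (_∖ suc (b + i)) (range-∖-head i (suc k))) (cong (range (suc i) (suc k) ∖_) (sym (+-suc b i))))
      jump≢hole : ¬ suc i + m ≡ suc (b + i)
      jump≢hole e = <-irrefl (sym (suc-injective e)) (subst (_< i + m) (+-comm i b) (+-monoʳ-< i b<m))
      jump≡ : Dec (m ≤ k) → jump ≡ walks (suc b) (m ∸ suc b) k
      jump≡ (yes m≤k) =
        one-* (trans (multiplicity-∖ (suc i + m) (suc (b + i)) R jump≢hole)
                     (multiplicity-range-in i (suc (suc k)) (suc i + m) (≤-trans (n≤1+n i) (m≤m+n (suc i) m)) i+m<))
              (trans (cong (λ v → windowCount k (U ∖ v) (suc (suc i))) (sym second-hole))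
                     (windowCount-twoHoles k i b (m ∸ suc b) (≤-trans (≤-reflexive (m+[n∸m]≡n b<m)) m≤k)
                                                               (≤-reflexive (m+[n∸m]≡n b<m))))
        where
        i+m< : suc i + m < i + suc (suc k)
        i+m< = ≤-trans (s≤s (s≤s (+-monoʳ-≤ i m≤k))) (≤-reflexive (sym (trans (+-suc i (suc k)) (cong suc (+-suc i k)))))
        second-hole : suc ((m ∸ suc b) + (suc b + i)) ≡ suc i + m
        second-hole = cong suc (trans (sym (+-assoc (m ∸ suc b) (suc b) i)) (trans (cong (_+ i) (m∸n+n≡m b<m)) (+-comm m i)))
      jump≡ (no m≰k) =
        trans (cong (_* windowCount k (U ∖ (suc i + m)) (suc (suc i)))
                    (trans (multiplicity-∖ (suc i + m) (suc (b + i)) R jump≢hole)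
                           (multiplicity-range-out i (suc (suc k)) (suc i + m)
                             (inj₂ (≤-trans (≤-reflexive (+-suc i (suc k))) (s≤s (+-monoʳ-≤ i (≰⇒> m≰k))))))))
              (sym (walks-zero (suc b) (m ∸ suc b) k (≤-trans (≰⇒> m≰k) (≤-reflexive (sym (m+[n∸m]≡n b<m))))))

    windowCount-twoHoles zero    j c b () _
    windowCount-twoHoles (suc k) j c b c+b<k c+b<m = begin
      windowCount (suc k) U (suc (suc j))
        ≡⟨ windowCount-split-2+ k U j ⟩
      multiplicity j U * windowCount k (U ∖ j) q′
        + multiplicity (suc j) U * windowCount k (U ∖ suc j) q′
        + multiplicity (suc (suc j) + m) U * windowCount k (U ∖ (suc (suc j) + m)) q′
        ≡⟨ cong₂ _+_ (cong₂ _+_ (one-* mult-j (trans (cong (λ V → windowCount k V q′) U∖j) (drop c c+b<k c+b<m)))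
                                (stranded-term k U (suc (suc j)) j (suc j) j∈U (λ e → <-irrefl e ≤-refl) ≤-refl ∣U∣≤1+k))
                     (stranded-term k U (suc (suc j)) j (suc (suc j) + m) j∈U
                       (λ e → <-irrefl e (≤-trans (n≤1+n _) (m≤m+n (suc (suc j)) m))) ≤-refl ∣U∣≤1+k) ⟩
      walks (suc c) b (suc k) + 0 + 0
        ≡⟨ trans (+-identityʳ _) (+-identityʳ _) ⟩
      walks (suc c) b (suc k) ∎
      where
      open ≡-Reasoning
      q′ : ℕ
      q′ = suc (suc (suc j))
      h₁ h₂ : ℕ
      h₁ = suc c + j
      h₂ = suc (b + h₁)
      R U : List ℕ
      R = range j (suc (suc (suc k)))
      U = R ∖ h₁ ∖ h₂
      j≢h₁ : ¬ j ≡ h₁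
      j≢h₁ e = <-irrefl e (s≤s (m≤n+m j c))
      j≢h₂ : ¬ j ≡ h₂
      j≢h₂ e = <-irrefl e (s≤s (≤-trans (≤-trans (m≤n+m j c) (n≤1+n _)) (m≤n+m _ b)))
      h₂≢h₁ : ¬ h₂ ≡ h₁
      h₂≢h₁ e = <-irrefl (sym e) (s≤s (m≤n+m _ b))
      mult-j : multiplicity j U ≡ 1
      mult-j = trans (multiplicity-∖ j h₂ (R ∖ h₁) j≢h₂)
                     (trans (multiplicity-∖ j h₁ R j≢h₁)
                            (multiplicity-range-in j (suc (suc (suc k))) j ≤-refl (m<m+n j (s≤s z≤n))))
      j∈U : 1 ≤ multiplicity j U
      j∈U = ≤-reflexive (sym mult-j)
      c+b≤k : c + b ≤ k
      c+b≤k = ≤-pred c+b<k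
      h₁<h₂ : h₁ < h₂
      h₁<h₂ = s≤s (m≤n+m h₁ b)
      h₂< : h₂ < j + suc (suc (suc k))
      h₂< = ≤-trans (≤-reflexive (e₁ b c j)) (≤-trans (+-monoˡ-≤ (j + 3) c+b≤k) (≤-reflexive (e₂ j k)))
        where
        e₁ : ∀ b c j → suc (suc (b + (suc c + j))) ≡ c + b + (j + 3)
        e₁ = solve-∀
        e₂ : ∀ j k → k + (j + 3) ≡ j + suc (suc (suc k))
        e₂ = solve-∀
      j≤h₁ : j ≤ h₁
      j≤h₁ = ≤-trans (m≤n+m j c) (n≤1+n _)
      ∣U∣≤1+k : length U ≤ suc k
      ∣U∣≤1+k = length-∖-member (suc k) h₂ (R ∖ h₁) h₂∈R∖h₁
                  (length-∖-member (suc (suc k)) h₁ R h₁∈R (≤-reflexive (length-range j _)))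
        where
        h₁∈R : 1 ≤ multiplicity h₁ R
        h₁∈R = ≤-reflexive (sym (multiplicity-range-in j _ h₁ j≤h₁ (<-trans h₁<h₂ h₂<)))
        h₂∈R∖h₁ : 1 ≤ multiplicity h₂ (R ∖ h₁)
        h₂∈R∖h₁ = ≤-reflexive (sym (trans (multiplicity-∖ h₂ h₁ R h₂≢h₁)
                                          (multiplicity-range-in j _ h₂ (≤-trans j≤h₁ (<⇒≤ h₁<h₂)) h₂<)))
      U∖j : U ∖ j ≡ range (suc j) (suc (suc k)) ∖ h₁ ∖ h₂
      U∖j = trans (∖-comm j h₂ (R ∖ h₁))
                  (cong (_∖ h₂) (trans (∖-comm j h₁ R) (cong (_∖ h₁) (range-∖-head j (suc (suc k))))))
      drop : ∀ c → suc c + b ≤ suc k → suc c + b ≤ m →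
             windowCount k (range (suc j) (suc (suc k)) ∖ (suc c + j) ∖ suc (b + (suc c + j))) q′ ≡ walks (suc c) b (suc k)
      drop zero    c+b<k c+b<m =
        trans (cong (λ V → windowCount k (V ∖ suc (b + suc j)) q′) (range-∖-head (suc j) (suc k)))
              (trans (cong (λ v → windowCount k (range (suc (suc j)) (suc k) ∖ v) q′) (sym (+-suc b (suc j))))
                     (windowCount-oneHole k (suc (suc j)) b (≤-trans (n≤1+n b) c+b<m) (≤-pred c+b<k)))
      drop (suc c) c+b<k c+b<m =
        trans (cong (λ v → windowCount k (range (suc j) (suc (suc k)) ∖ v ∖ suc (b + v)) q′) (sym (cong suc (+-suc c j))))
              (windowCount-twoHoles k (suc j) c b (≤-pred c+b<k) (≤-trans (n≤1+n _) c+b<m))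

    P≡walks : ∀ n → P W n ≡ walks 0 0 n
    P≡walks n = begin
      P W n                                   ≡⟨ P≡windowCount n ⟩
      windowCount n (range 1 n) 1             ≡⟨ cong (λ V → windowCount n V 1) (sym (range-∖-head 0 n)) ⟩
      windowCount n (range 0 (suc n) ∖ 0) 1   ≡⟨ windowCount-oneHole n 0 0 z≤n z≤n ⟩
      walks 0 0 n                             ∎
      where open ≡-Reasoning

module Convolution where

  open import Defs
  open import Data.Nat as ℕ using (ℕ; zero; suc; z≤n; s≤s)
  import Data.Nat.Properties as ℕ
  open import Data.Integer using (ℤ; +_; -[1+_]; _+_; _-_; _*_; _<_; ∣_∣; _⊖_; -_; -<+)
  import Data.Integer.Properties as ℤ
  open import Data.Integer.Tactic.RingSolver using (solve-∀)
  open import Data.List using (foldr; applyUpTo)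
  open import Data.List.Properties using (map-upTo)
  open import Data.Product using (_,_)
  open import Data.Empty using (⊥-elim)
  open import Relation.Nullary using (yes; no; ¬_)
  open import Relation.Binary.PropositionalEquality
  open import Function using (_∘_)
  open Counting using (module ThreeWindow)

  sumBelow : ℕ → (ℕ → ℤ) → ℤ
  sumBelow zero    f = + 0
  sumBelow (suc n) f = f 0 + sumBelow n (f ∘ suc)

  sumBelow-cong : ∀ n {f g : ℕ → ℤ} → (∀ i → i ℕ.< n → f i ≡ g i) → sumBelow n f ≡ sumBelow n g
  sumBelow-cong zero    e = refl
  sumBelow-cong (suc n) e = cong₂ _+_ (e 0 (s≤s z≤n)) (sumBelow-cong n (λ i i<n → e (suc i) (s≤s i<n)))

  sumBelow-zero : ∀ n (f : ℕ → ℤ) → (∀ i → i ℕ.< n → f i ≡ + 0) → sumBelow n f ≡ + 0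
  sumBelow-zero zero    f e = refl
  sumBelow-zero (suc n) f e rewrite e 0 (s≤s z≤n) =
    trans (ℤ.+-identityˡ _) (sumBelow-zero n (f ∘ suc) (λ i i<n → e (suc i) (s≤s i<n)))

  sumBelow-+ : ∀ n (f g : ℕ → ℤ) → sumBelow n (λ i → f i + g i) ≡ sumBelow n f + sumBelow n g
  sumBelow-+ zero    f g = refl
  sumBelow-+ (suc n) f g rewrite sumBelow-+ n (f ∘ suc) (g ∘ suc) =
    interchange (f 0) (g 0) (sumBelow n (f ∘ suc)) (sumBelow n (g ∘ suc))
    where
    interchange : ∀ a b c d → a + b + (c + d) ≡ a + c + (b + d)
    interchange = solve-∀

  sumBelow-*ˡ : ∀ n c (f : ℕ → ℤ) → sumBelow n (λ i → c * f i) ≡ c * sumBelow n f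
  sumBelow-*ˡ zero    c f = sym (ℤ.*-zeroʳ c)
  sumBelow-*ˡ (suc n) c f rewrite sumBelow-*ˡ n c (f ∘ suc) = sym (ℤ.*-distribˡ-+ c (f 0) _)

  sumBelow-dropZeros : ∀ c n (f : ℕ → ℤ) → (∀ i → i ℕ.< c → f i ≡ + 0) →
                       sumBelow (c ℕ.+ n) f ≡ sumBelow n (λ v → f (c ℕ.+ v))
  sumBelow-dropZeros zero    n f e = refl
  sumBelow-dropZeros (suc c) n f e rewrite e 0 (s≤s z≤n) =
    trans (ℤ.+-identityˡ _) (sumBelow-dropZeros c n (f ∘ suc) (λ i i<c → e (suc i) (s≤s i<c)))

  sumBelow-padZeros : ∀ k d (f : ℕ → ℤ) → (∀ i → k ℕ.≤ i → f i ≡ + 0) → sumBelow k f ≡ sumBelow (k ℕ.+ d) f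
  sumBelow-padZeros zero    d f e = sym (sumBelow-zero d f (λ i _ → e i z≤n))
  sumBelow-padZeros (suc k) d f e = cong (_+_ (f 0)) (sumBelow-padZeros k d (f ∘ suc) (λ i k≤i → e (suc i) (s≤s k≤i)))

  sumBelow-snoc : ∀ n (f : ℕ → ℤ) → sumBelow (suc n) f ≡ sumBelow n f + f n
  sumBelow-snoc zero    f = trans (ℤ.+-identityʳ (f 0)) (sym (ℤ.+-identityˡ (f 0)))
  sumBelow-snoc (suc n) f rewrite sumBelow-snoc n (f ∘ suc) = sym (ℤ.+-assoc (f 0) _ _)

  sumBelow-reverse : ∀ n (f : ℕ → ℤ) → sumBelow (suc n) f ≡ sumBelow (suc n) (λ i → f (n ℕ.∸ i))
  sumBelow-reverse zero    f = refl
  sumBelow-reverse (suc n) f = begin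
    f 0 + sumBelow (suc n) (f ∘ suc)
      ≡⟨ cong (_+_ (f 0)) (sumBelow-reverse n (f ∘ suc)) ⟩
    f 0 + sumBelow (suc n) (λ i → f (suc (n ℕ.∸ i)))
      ≡⟨ ℤ.+-comm (f 0) _ ⟩
    sumBelow (suc n) (λ i → f (suc (n ℕ.∸ i))) + f 0
      ≡⟨ cong₂ _+_ (sumBelow-cong (suc n) (λ i i<1+n → cong f (sym (ℕ.+-∸-assoc 1 (ℕ.≤-pred i<1+n)))))
                   (cong f (sym (ℕ.n∸n≡0 (suc n)))) ⟩
    sumBelow (suc n) (λ i → f (suc n ℕ.∸ i)) + f (suc n ℕ.∸ suc n)
      ≡⟨ sym (sumBelow-snoc (suc n) (λ i → f (suc n ℕ.∸ i))) ⟩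
    sumBelow (suc (suc n)) (λ i → f (suc n ℕ.∸ i)) ∎
    where open ≡-Reasoning

  m<n∸o⇒m+o<n : ∀ a b c → a ℕ.< b ℕ.∸ c → a ℕ.+ c ℕ.< b
  m<n∸o⇒m+o<n a b c a<b∸c with c ℕ.≤? b
  ... | yes c≤b = ℕ.m≤o∸n⇒m+n≤o (suc a) c≤b a<b∸c
  ... | no c≰b with () ← ℕ.≤-trans a<b∸c (ℕ.≤-reflexive (ℕ.m≤n⇒m∸n≡0 (ℕ.<⇒≤ (ℕ.≰⇒> c≰b))))

  δ-yes : ∀ a d → a ≡ d → δ a d ≡ + 1
  δ-yes a d a≡d with a ℕ.≟ d
  ... | yes _   = refl
  ... | no a≢d  = ⊥-elim (a≢d a≡d)

  δ-no : ∀ a d → ¬ a ≡ d → δ a d ≡ + 0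
  δ-no a d a≢d with a ℕ.≟ d
  ... | yes a≡d = ⊥-elim (a≢d a≡d)
  ... | no _    = refl

  sumBelow-pickδ : ∀ N (g : ℕ → ℤ) c d → d ℕ.< N → sumBelow N (λ j → g j * δ (c ℕ.+ d) (j ℕ.+ c)) ≡ g d
  sumBelow-pickδ (suc N) g c zero _ = begin
    g 0 * δ (c ℕ.+ 0) c + sumBelow N (λ j → g (suc j) * δ (c ℕ.+ 0) (suc j ℕ.+ c))
      ≡⟨ cong₂ _+_ (cong (g 0 *_) (δ-yes (c ℕ.+ 0) c (ℕ.+-identityʳ c)))
                   (sumBelow-zero N _ (λ j _ → trans (cong (g (suc j) *_) (δ-no (c ℕ.+ 0) (suc j ℕ.+ c) (c≢ j)))
                                                      (ℤ.*-zeroʳ (g (suc j))))) ⟩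
    g 0 * + 1 + + 0
      ≡⟨ trans (ℤ.+-identityʳ _) (ℤ.*-identityʳ (g 0)) ⟩
    g 0 ∎
    where
    open ≡-Reasoning
    c≢ : ∀ j → ¬ c ℕ.+ 0 ≡ suc j ℕ.+ c
    c≢ j e = ℕ.<-irrefl (trans (sym (ℕ.+-identityʳ c)) (trans e (ℕ.+-comm (suc j) c))) (ℕ.m<m+n c (s≤s z≤n))
  sumBelow-pickδ (suc N) g c (suc d) (s≤s d<N) = begin
    g 0 * δ (c ℕ.+ suc d) c + sumBelow N (λ j → g (suc j) * δ (c ℕ.+ suc d) (suc j ℕ.+ c))
      ≡⟨ cong₂ _+_ (trans (cong (g 0 *_) (δ-no (c ℕ.+ suc d) c (λ e → ℕ.<-irrefl (sym e) (ℕ.m<m+n c (s≤s z≤n)))))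
                          (ℤ.*-zeroʳ (g 0)))
                   (sumBelow-cong N (λ j _ → cong (g (suc j) *_) (cong₂ δ (ℕ.+-suc c d) (sym (ℕ.+-suc j c))))) ⟩
    + 0 + sumBelow N (λ j → g (suc j) * δ (suc c ℕ.+ d) (j ℕ.+ suc c))
      ≡⟨ trans (ℤ.+-identityˡ _) (sumBelow-pickδ N (g ∘ suc) (suc c) d d<N) ⟩
    g (suc d) ∎
    where open ≡-Reasoning

  foldr-applyUpTo : ∀ n (g : ℕ → ℤ) → foldr _+_ (+ 0) (applyUpTo g n) ≡ sumBelow n g
  foldr-applyUpTo zero    g = refl
  foldr-applyUpTo (suc n) g = cong (_+_ (g 0)) (foldr-applyUpTo n (g ∘ suc))

  Σ[⋯]≡sumBelow : ∀ a b (f : ℤ → ℤ) → Σ[ a ⋯ b ] f ≡ sumBelow (rangeLen a b) (λ i → f (a + + i))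
  Σ[⋯]≡sumBelow a b f =
    trans (cong (foldr _+_ (+ 0)) (map-upTo (λ i → f (a + + i)) (rangeLen a b))) (foldr-applyUpTo (rangeLen a b) _)

  rangeLen≡∸ : ∀ x y p q → y - x + + 1 ≡ p ⊖ q → rangeLen x y ≡ p ℕ.∸ q
  rangeLen≡∸ x y p q eq with y - x + + 1
  rangeLen≡∸ x y p q eq | + k with q ℕ.≤? p
  ... | yes q≤p = ℤ.+-injective (trans eq (ℤ.⊖-≥ q≤p))
  ... | no q≰p with q ℕ.∸ p in q∸p | trans eq (ℤ.⊖-≰ q≰p)
  ...   | zero  | _  = ⊥-elim (q≰p (ℕ.m∸n≡0⇒m≤n q∸p))
  ...   | suc _ | ()
  rangeLen≡∸ x y p q eq | -[1+ k ] with q ℕ.≤? p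
  ... | yes q≤p with () ← trans eq (ℤ.⊖-≥ q≤p)
  ... | no q≰p = sym (ℕ.m≤n⇒m∸n≡0 (ℕ.≤-trans (ℕ.n≤1+n p) (ℕ.≰⇒> q≰p)))

  module Recurrence (m : ℕ) (s : ℤ → ℤ) (s-neg : ∀ n → n < + 0 → s n ≡ + 0)
           (s-rec : ∀ (n : ℕ) → s (+ n) ≡ δ n 0 + s (+ n - + 1) + s (+ n - + (m ℕ.+ 2))) where

    open ThreeWindow m using (W; walks; walks-zero; walks-shift; P≡walks)

    sq : ℤ → ℤ
    sq x = x * x

    sn : ℕ → ℤ
    sn a = s (+ a)

    -- S a b is s_{a-b}, taking the difference in ℤ rather than with truncated ℕ subtraction
    S : ℕ → ℕ → ℤ
    S a b = s (a ⊖ b)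

    S-neg : ∀ a b → a ℕ.< b → S a b ≡ + 0
    S-neg a b a<b = s-neg (a ⊖ b) (subst (_< + 0) (sym (ℤ.⊖-< a<b)) (-suc<0 (b ℕ.∸ a) (ℕ.m<n⇒0<n∸m a<b)))
      where
      -suc<0 : ∀ k → 0 ℕ.< k → - (+ k) < + 0
      -suc<0 (suc k) _ = -<+

    S-cancel : ∀ c a b → S (c ℕ.+ a) (c ℕ.+ b) ≡ S a b
    S-cancel c a b = cong s (ℤ.+-cancelˡ-⊖ c a b)

    S-0 : ∀ a → S a 0 ≡ sn a
    S-0 a = cong s (ℤ.⊖-≥ z≤n)

    S-+ : ∀ b e → S (b ℕ.+ e) b ≡ sn e
    S-+ b e = trans (cong (S (b ℕ.+ e)) (sym (ℕ.+-identityʳ b))) (trans (S-cancel b e 0) (S-0 e))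

    s-recS : ∀ e → sn e ≡ δ e 0 + S e 1 + S e (m ℕ.+ 2)
    s-recS e = trans (s-rec e) (cong₂ (λ x y → δ e 0 + s x + s y) (ℤ.[+m]-[+n]≡m⊖n e 1) (ℤ.[+m]-[+n]≡m⊖n e (m ℕ.+ 2)))

    δ-shift : ∀ d e → δ (d ℕ.+ e) d ≡ δ e 0
    δ-shift d zero    = δ-yes (d ℕ.+ 0) d (ℕ.+-identityʳ d)
    δ-shift d (suc e) = δ-no (d ℕ.+ suc e) d (λ eq → ℕ.<-irrefl (sym eq) (ℕ.m<m+n d (s≤s z≤n)))

    S-rec : ∀ a d → S a d ≡ δ a d + S a (suc d) + S a (d ℕ.+ (m ℕ.+ 2))
    S-rec a d with d ℕ.≤? a
    ... | yes d≤a with ℕ.m≤n⇒∃[o]m+o≡n d≤a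
    ...   | e , refl = begin
      S (d ℕ.+ e) d
        ≡⟨ S-+ d e ⟩
      sn e
        ≡⟨ s-recS e ⟩
      δ e 0 + S e 1 + S e (m ℕ.+ 2)
        ≡⟨ cong₂ _+_ (cong₂ _+_ (sym (δ-shift d e)) (trans (sym (S-cancel d e 1)) (cong (S (d ℕ.+ e)) (ℕ.+-comm d 1))))
                     (sym (S-cancel d e (m ℕ.+ 2))) ⟩
      δ (d ℕ.+ e) d + S (d ℕ.+ e) (suc d) + S (d ℕ.+ e) (d ℕ.+ (m ℕ.+ 2)) ∎
      where open ≡-Reasoning
    S-rec a d | no d≰a = begin
      S a d
        ≡⟨ S-neg a d a<d ⟩
      + 0
        ≡⟨ sym (cong₂ _+_ (cong₂ _+_ (δ-no a d (λ e → ℕ.<-irrefl e a<d))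
                                     (S-neg a (suc d) (ℕ.≤-trans a<d (ℕ.n≤1+n d))))
                          (S-neg a (d ℕ.+ (m ℕ.+ 2)) (ℕ.≤-trans a<d (ℕ.m≤m+n d _)))) ⟩
      δ a d + S a (suc d) + S a (d ℕ.+ (m ℕ.+ 2)) ∎
      where
      open ≡-Reasoning
      a<d = ℕ.≰⇒> d≰a

    s-suc : ∀ L → sn (suc L) ≡ sn L + S L (suc m)
    s-suc L = begin
      sn (suc L)
        ≡⟨ s-recS (suc L) ⟩
      δ (suc L) 0 + S (suc L) 1 + S (suc L) (m ℕ.+ 2)
        ≡⟨ cong₂ _+_ (cong₂ _+_ (δ-no (suc L) 0 (λ ())) (trans (S-cancel 1 L 0) (S-0 L)))
                     (trans (cong (S (suc L)) (ℕ.+-comm m 2)) (S-cancel 1 L (suc m))) ⟩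
      + 0 + sn L + S L (suc m)
        ≡⟨ cong (_+ S L (suc m)) (ℤ.+-identityˡ (sn L)) ⟩
      sn L + S L (suc m) ∎
      where open ≡-Reasoning

    product-formula : ∀ fuel L b → L ℕ.≤ fuel → b ℕ.≤ m →
      sn L * S L (suc b) ≡ sumBelow L (λ t → + walks 0 b t * sq (S L (suc t)))
    delayed-product : ∀ fuel L b → L ℕ.≤ fuel → suc b ℕ.≤ m →
      sumBelow L (λ u → + walks (suc b) (m ℕ.∸ suc b) u * sq (S L (suc u))) ≡ S L (suc b) * S L (suc m)

    product-formula _ zero b _ _ = trans (cong (sn 0 *_) (S-neg 0 (suc b) (s≤s z≤n))) (ℤ.*-zeroʳ (sn 0))
    product-formula (suc fuel) (suc L) zero (s≤s L≤fuel) _ = begin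
      sn (suc L) * S (suc L) 1
        ≡⟨ cong₂ _*_ (s-suc L) S[1+L]1 ⟩
      (sn L + S L (suc m)) * sn L
        ≡⟨ expand (sn L) (S L (suc m)) ⟩
      + 1 * sq (sn L) + sn L * S L (suc m)
        ≡⟨ cong₂ _+_ (cong (λ z → + 1 * sq z) (sym S[1+L]1))
                     (trans (product-formula fuel L m L≤fuel ℕ.≤-refl)
                            (sumBelow-cong L (λ u _ → cong (λ z → + walks 0 m u * sq z) (sym (S-cancel 1 L (suc u)))))) ⟩
      sumBelow (suc L) (λ t → + walks 0 0 t * sq (S (suc L) (suc t))) ∎
      where
      open ≡-Reasoning
      S[1+L]1 : S (suc L) 1 ≡ sn L
      S[1+L]1 = trans (S-cancel 1 L 0) (S-0 L)
      expand : ∀ x y → (x + y) * x ≡ + 1 * (x * x) + x * y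
      expand = solve-∀
    product-formula (suc fuel) (suc L) (suc b) (s≤s L≤fuel) b<m = begin
      sn (suc L) * S (suc L) (suc (suc b))
        ≡⟨ cong₂ _*_ (s-suc L) (S-cancel 1 L (suc b)) ⟩
      (sn L + S L (suc m)) * S L (suc b)
        ≡⟨ expand (sn L) (S L (suc m)) (S L (suc b)) ⟩
      sn L * S L (suc b) + S L (suc b) * S L (suc m)
        ≡⟨ cong₂ _+_ (product-formula fuel L b L≤fuel (ℕ.≤-trans (ℕ.n≤1+n b) b<m))
                     (sym (delayed-product fuel L b L≤fuel b<m)) ⟩
      sumBelow L A + sumBelow L B
        ≡⟨ sym (trans (sumBelow-cong L (λ u _ → split u)) (sumBelow-+ L A B)) ⟩
      sumBelow L (λ u → + walks 0 (suc b) (suc u) * sq (S (suc L) (suc (suc u))))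
        ≡⟨ sym (ℤ.+-identityˡ _) ⟩
      sumBelow (suc L) (λ t → + walks 0 (suc b) t * sq (S (suc L) (suc t))) ∎
      where
      open ≡-Reasoning
      A B : ℕ → ℤ
      A u = + walks 0 b u * sq (S L (suc u))
      B u = + walks (suc b) (m ℕ.∸ suc b) u * sq (S L (suc u))
      split : ∀ u → + walks 0 (suc b) (suc u) * sq (S (suc L) (suc (suc u))) ≡ A u + B u
      split u = trans (cong (λ z → + walks 0 (suc b) (suc u) * sq z) (S-cancel 1 L (suc u)))
                      (ℤ.*-distribʳ-+ (sq (S L (suc u))) (+ walks 0 b u) (+ walks (suc b) (m ℕ.∸ suc b) u))
      expand : ∀ a x y → (a + x) * y ≡ a * y + y * x
      expand = solve-∀

    delayed-product fuel L b L≤fuel b<m with suc b ℕ.≤? L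
    ... | yes b<L with ℕ.m≤n⇒∃[o]m+o≡n b<L
    ...   | L′ , refl = begin
      sumBelow (suc b ℕ.+ L′) B
        ≡⟨ sumBelow-dropZeros (suc b) L′ B (λ i i<b → cong (λ w → + w * sq (S (suc b ℕ.+ L′) (suc i)))
                                                            (walks-zero (suc b) B′ i (ℕ.≤-trans i<b (ℕ.m≤m+n (suc b) B′)))) ⟩
      sumBelow L′ (λ v → B (suc b ℕ.+ v))
        ≡⟨ sumBelow-cong L′ (λ v _ → cong₂ (λ x y → + x * sq y) (walks-shift (suc b) B′ v)
                                            (trans (cong (S (suc b ℕ.+ L′)) (sym (ℕ.+-suc (suc b) v)))
                                                   (S-cancel (suc b) L′ (suc v)))) ⟩
      sumBelow L′ (λ v → + walks 0 B′ v * sq (S L′ (suc v)))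
        ≡⟨ sym (product-formula fuel L′ B′ (ℕ.≤-trans (ℕ.m≤n+m L′ (suc b)) L≤fuel) (ℕ.m∸n≤m m (suc b))) ⟩
      sn L′ * S L′ (suc B′)
        ≡⟨ cong₂ _*_ (sym (S-+ (suc b) L′))
                     (sym (trans (cong (S (suc b ℕ.+ L′)) 1+m≡) (S-cancel (suc b) L′ (suc B′)))) ⟩
      S (suc b ℕ.+ L′) (suc b) * S (suc b ℕ.+ L′) (suc m) ∎
      where
      open ≡-Reasoning
      B′ : ℕ
      B′ = m ℕ.∸ suc b
      B : ℕ → ℤ
      B u = + walks (suc b) B′ u * sq (S (suc b ℕ.+ L′) (suc u))
      1+m≡ : suc m ≡ suc b ℕ.+ suc B′
      1+m≡ = trans (cong suc (sym (ℕ.m+[n∸m]≡n b<m))) (sym (ℕ.+-suc (suc b) B′))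
    delayed-product fuel L b L≤fuel b<m | no b≮L =
      trans (sumBelow-zero L _ (λ u u<L → cong (λ w → + w * sq (S L (suc u)))
                                               (walks-zero (suc b) (m ℕ.∸ suc b) u
                                                 (ℕ.≤-trans (ℕ.<-trans u<L L<1+b) (ℕ.m≤m+n (suc b) _)))))
            (sym (trans (cong (_* S L (suc m)) (S-neg L (suc b) L<1+b)) (ℤ.*-zeroˡ (S L (suc m)))))
      where
      L<1+b : L ℕ.< suc b
      L<1+b = ℕ.≰⇒> b≮L

    E : ℕ → ℤ
    E j = S j 1 * S j (m ℕ.+ 2)

    E⋆S : ℕ → ℕ → ℤ
    E⋆S a c = sumBelow (suc a) (λ j → E j * S a (j ℕ.+ c))

    E⋆S-rec : ∀ c d → E⋆S (c ℕ.+ d) c ≡ E d + E⋆S (c ℕ.+ d) (suc c) + E⋆S (c ℕ.+ d) (c ℕ.+ (m ℕ.+ 2))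
    E⋆S-rec c d = begin
      sumBelow (suc a) (λ j → E j * S a (j ℕ.+ c))
        ≡⟨ sumBelow-cong (suc a) (λ j _ → trans (cong (E j *_) (S-rec a (j ℕ.+ c)))
                                                (distrib₃ (E j) (δ a (j ℕ.+ c)) (S a (suc (j ℕ.+ c)))
                                                          (S a (j ℕ.+ c ℕ.+ (m ℕ.+ 2))))) ⟩
      sumBelow (suc a) (λ j → at j + next j + jump j)
        ≡⟨ trans (sumBelow-+ (suc a) (λ j → at j + next j) jump) (cong (_+ sumBelow (suc a) jump) (sumBelow-+ (suc a) at next)) ⟩
      sumBelow (suc a) at + sumBelow (suc a) next + sumBelow (suc a) jump
        ≡⟨ cong₂ _+_ (cong₂ _+_ (sumBelow-pickδ (suc a) E c d (s≤s (ℕ.m≤n+m d c)))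
                                (sumBelow-cong (suc a) (λ j _ → cong (λ z → E j * S a z) (sym (ℕ.+-suc j c)))))
                     (sumBelow-cong (suc a) (λ j _ → cong (λ z → E j * S a z) (ℕ.+-assoc j c (m ℕ.+ 2)))) ⟩
      E d + E⋆S a (suc c) + E⋆S a (c ℕ.+ (m ℕ.+ 2)) ∎
      where
      open ≡-Reasoning
      a : ℕ
      a = c ℕ.+ d
      at next jump : ℕ → ℤ
      at j   = E j * δ a (j ℕ.+ c)
      next j = E j * S a (suc (j ℕ.+ c))
      jump j = E j * S a (j ℕ.+ c ℕ.+ (m ℕ.+ 2))
      distrib₃ : ∀ e x y z → e * (x + y + z) ≡ e * x + e * y + e * z
      distrib₃ = solve-∀

    E⋆S-vanish : ∀ a c → a ℕ.< c → E⋆S a c ≡ + 0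
    E⋆S-vanish a c a<c = sumBelow-zero (suc a) _
      (λ j _ → trans (cong (E j *_) (S-neg a (j ℕ.+ c) (ℕ.≤-trans a<c (ℕ.m≤n+m c j)))) (ℤ.*-zeroʳ (E j)))

    square-step : ∀ c d → let a = c ℕ.+ d in
      + 2 * E d + (sq (S a (suc c)) - S a (suc c)) + (sq (S a (c ℕ.+ (m ℕ.+ 2))) - S a (c ℕ.+ (m ℕ.+ 2)))
        ≡ sq (S a c) - S a c
    square-step c zero
      rewrite S-neg (c ℕ.+ 0) (suc c) (s≤s (ℕ.≤-reflexive (ℕ.+-identityʳ c)))
            | S-neg (c ℕ.+ 0) (c ℕ.+ (m ℕ.+ 2)) (ℕ.+-monoʳ-< c (ℕ.≤-trans (s≤s z≤n) (ℕ.m≤n+m 2 m)))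
            | S-neg 0 1 (s≤s z≤n)
            | S-+ c 0 | s-recS 0 | δ-yes 0 0 refl | S-neg 0 1 (s≤s z≤n)
            | S-neg 0 (m ℕ.+ 2) (ℕ.≤-trans (s≤s z≤n) (ℕ.m≤n+m 2 m)) = refl
    square-step c (suc d) = begin
      + 2 * E (suc d) + (sq (S a (suc c)) - S a (suc c)) + (sq (S a (c ℕ.+ (m ℕ.+ 2))) - S a (c ℕ.+ (m ℕ.+ 2)))
        ≡⟨ cong₂ _+_ (cong (λ w → + 2 * E (suc d) + (sq w - w)) y≡) (cong (λ w → sq w - w) z≡) ⟩
      + 2 * (y * z) + (sq y - y) + (sq z - z)
        ≡⟨ expand y z ⟩
      sq (+ 0 + y + z) - (+ 0 + y + z)
        ≡⟨ cong (λ w → sq w - w) (sym (trans (S-rec a c) (cong₂ _+_ (cong₂ _+_ (δ-no a c a≢c) y≡) z≡))) ⟩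
      sq (S a c) - S a c ∎
      where
      open ≡-Reasoning
      a : ℕ
      a = c ℕ.+ suc d
      y z : ℤ
      y = S (suc d) 1
      z = S (suc d) (m ℕ.+ 2)
      y≡ : S a (suc c) ≡ y
      y≡ = trans (cong (S a) (ℕ.+-comm 1 c)) (S-cancel c (suc d) 1)
      z≡ : S a (c ℕ.+ (m ℕ.+ 2)) ≡ z
      z≡ = S-cancel c (suc d) (m ℕ.+ 2)
      a≢c : ¬ a ≡ c
      a≢c e = ℕ.<-irrefl (sym e) (ℕ.m<m+n c (s≤s z≤n))
      expand : ∀ y z → + 2 * (y * z) + (y * y - y) + (z * z - z) ≡ (+ 0 + y + z) * (+ 0 + y + z) - (+ 0 + y + z)
      expand = solve-∀

    convolution : ∀ fuel a c → a ℕ.< c ℕ.+ fuel → + 2 * E⋆S a c ≡ sq (S a c) - S a c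
    convolution fuel a c a<c+fuel with c ℕ.≤? a
    convolution fuel a c a<c+fuel | no c≰a =
      trans (cong (+ 2 *_) (E⋆S-vanish a c (ℕ.≰⇒> c≰a))) (sym (cong (λ z → sq z - z) (S-neg a c (ℕ.≰⇒> c≰a))))
    convolution zero a c a<c | yes c≤a =
      ⊥-elim (ℕ.<-irrefl refl (ℕ.≤-trans a<c (ℕ.≤-trans (ℕ.≤-reflexive (ℕ.+-identityʳ c)) c≤a)))
    convolution (suc fuel) a c a<c+fuel | yes c≤a with ℕ.m≤n⇒∃[o]m+o≡n c≤a
    ... | d , refl = begin
      + 2 * E⋆S (c ℕ.+ d) c
        ≡⟨ cong (+ 2 *_) (E⋆S-rec c d) ⟩
      + 2 * (E d + E⋆S (c ℕ.+ d) (suc c) + E⋆S (c ℕ.+ d) (c ℕ.+ (m ℕ.+ 2)))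
        ≡⟨ *-distrib₃ (E d) _ _ ⟩
      + 2 * E d + + 2 * E⋆S (c ℕ.+ d) (suc c) + + 2 * E⋆S (c ℕ.+ d) (c ℕ.+ (m ℕ.+ 2))
        ≡⟨ cong₂ _+_ (cong (_+_ (+ 2 * E d))
                           (convolution fuel (c ℕ.+ d) (suc c) (ℕ.≤-trans a<c+fuel (ℕ.≤-reflexive (ℕ.+-suc c fuel)))))
                     (convolution fuel (c ℕ.+ d) (c ℕ.+ (m ℕ.+ 2)) a<c+m+2+fuel) ⟩
      _ ≡⟨ square-step c d ⟩
      sq (S (c ℕ.+ d) c) - S (c ℕ.+ d) c ∎
      where
      open ≡-Reasoning
      *-distrib₃ : ∀ p q r → + 2 * (p + q + r) ≡ + 2 * p + + 2 * q + + 2 * r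
      *-distrib₃ = solve-∀
      a<c+m+2+fuel : c ℕ.+ d ℕ.< c ℕ.+ (m ℕ.+ 2) ℕ.+ fuel
      a<c+m+2+fuel = ℕ.≤-trans a<c+fuel (ℕ.≤-trans (ℕ.≤-reflexive (sym (ℕ.+-assoc c 1 fuel)))
                                                   (ℕ.+-monoˡ-≤ fuel (ℕ.+-monoʳ-≤ c (ℕ.≤-trans (s≤s z≤n) (ℕ.m≤n+m 2 m)))))

    m₂ : ℕ
    m₂ = m ℕ.+ 2

    E-as-walkSum : ∀ w → sumBelow (suc w) (λ v → + walks 0 m (m ℕ.+ v) * sq (S w v)) ≡ E (m₂ ℕ.+ w)
    E-as-walkSum w = begin
      sumBelow (suc w) (λ v → + walks 0 m (m ℕ.+ v) * sq (S w v))
        ≡⟨ sumBelow-cong (suc w) (λ v _ → cong (λ z → + walks 0 m (m ℕ.+ v) * sq z) (sym (S-at v))) ⟩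
      sumBelow (suc w) (λ v → term (m ℕ.+ v))
        ≡⟨ sym (sumBelow-dropZeros m (suc w) term (λ t t<m → cong (λ z → + z * sq (S L (suc t))) (walks-zero 0 m t t<m))) ⟩
      sumBelow L term
        ≡⟨ sym (product-formula L L m ℕ.≤-refl ℕ.≤-refl) ⟩
      sn L * S L (suc m)
        ≡⟨ cong₂ _*_ (sym (trans (cong (λ z → S z 1) m₂+w≡1+L) (trans (S-cancel 1 L 0) (S-0 L))))
                     (trans (cong (S L) (ℕ.+-comm 1 m)) (trans (S-cancel m (suc w) 1)
                            (trans (S-cancel 1 w 0) (trans (S-0 w) (sym (S-+ m₂ w)))))) ⟩
      E (m₂ ℕ.+ w) ∎
      where
      open ≡-Reasoning
      L : ℕ
      L = m ℕ.+ suc w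
      term : ℕ → ℤ
      term t = + walks 0 m t * sq (S L (suc t))
      S-at : ∀ v → S L (suc (m ℕ.+ v)) ≡ S w v
      S-at v = trans (cong (S L) (sym (ℕ.+-suc m v))) (trans (S-cancel m (suc w) (suc v)) (S-cancel 1 w v))
      m₂+w≡1+L : m₂ ℕ.+ w ≡ suc L
      m₂+w≡1+L = trans (ℕ.+-assoc m 2 w) (ℕ.+-suc m (suc w))

    s-diff : ∀ n i w → s (+ n - + i - + w) ≡ S n (i ℕ.+ w)
    s-diff n i w = cong s (trans (sub-sub (+ n) (+ i) (+ w)) (ℤ.[+m]-[+n]≡m⊖n n (i ℕ.+ w)))
      where
      sub-sub : ∀ a b c → a - b - c ≡ a - (b + c)
      sub-sub = solve-∀

    P-index : ∀ v → ∣ (+ m₂ + + v) - + 1 ∣ ≡ suc (m ℕ.+ v)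
    P-index v = begin
      ∣ + (m₂ ℕ.+ v) - + 1 ∣        ≡⟨ cong ∣_∣ (ℤ.[+m]-[+n]≡m⊖n (m₂ ℕ.+ v) 1) ⟩
      ∣ (m₂ ℕ.+ v) ⊖ 1 ∣            ≡⟨ cong (λ z → ∣ z ⊖ 1 ∣) m₂+v≡ ⟩
      suc (m ℕ.+ v)                ∎
      where
      open ≡-Reasoning
      m₂+v≡ : m₂ ℕ.+ v ≡ suc (suc (m ℕ.+ v))
      m₂+v≡ = trans (ℕ.+-assoc m 2 v) (trans (ℕ.+-suc m (suc v)) (cong suc (ℕ.+-suc m v)))

    doubleSum : ℕ → ℤ
    doubleSum n = Σ[ + 0 ⋯ + n - + m₂ ] (λ k → Σ[ + m₂ ⋯ + n - k ] (λ r →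
                    + P W (∣ r - + 1 ∣) * s k * (s (+ n - k - r) * s (+ n - k - r))))

    walkSum : ℕ → ℕ → ℤ
    walkSum n i = sumBelow (suc n ℕ.∸ (i ℕ.+ m₂)) (λ v → + walks 0 m (m ℕ.+ v) * sq (S n (i ℕ.+ (m₂ ℕ.+ v))))

    doubleSum≡ : ∀ n → doubleSum n ≡ sumBelow (suc n ℕ.∸ m₂) (λ i → sn i * walkSum n i)
    doubleSum≡ n = begin
      Σ[ + 0 ⋯ + n - + m₂ ] outer
        ≡⟨ Σ[⋯]≡sumBelow (+ 0) (+ n - + m₂) outer ⟩
      sumBelow (rangeLen (+ 0) (+ n - + m₂)) (λ i → outer (+ i))
        ≡⟨ cong (λ L → sumBelow L (λ i → outer (+ i)))
                (rangeLen≡∸ (+ 0) (+ n - + m₂) (suc n) m₂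
                            (trans (shift₁ (+ n) (+ m₂)) (ℤ.[+m]-[+n]≡m⊖n (suc n) m₂))) ⟩
      sumBelow (suc n ℕ.∸ m₂) (λ i → outer (+ i))
        ≡⟨ sumBelow-cong (suc n ℕ.∸ m₂) (λ i _ → inner i) ⟩
      sumBelow (suc n ℕ.∸ m₂) (λ i → sn i * walkSum n i) ∎
      where
      open ≡-Reasoning
      term : ℤ → ℤ → ℤ
      term k r = + P W (∣ r - + 1 ∣) * s k * (s (+ n - k - r) * s (+ n - k - r))
      outer : ℤ → ℤ
      outer k = Σ[ + m₂ ⋯ + n - k ] (term k)
      shift₁ : ∀ a b → a - b - + 0 + + 1 ≡ + 1 + a - b
      shift₁ = solve-∀
      shift₂ : ∀ a b c → a - b - c + + 1 ≡ + 1 + a - (b + c)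
      shift₂ = solve-∀
      rearrange : ∀ a b c → a * b * c ≡ b * (a * c)
      rearrange = solve-∀
      term≡ : ∀ i v → term (+ i) (+ m₂ + + v) ≡ sn i * (+ walks 0 m (m ℕ.+ v) * sq (S n (i ℕ.+ (m₂ ℕ.+ v))))
      term≡ i v =
        trans (cong₂ (λ p x → + p * sn i * sq x) (trans (cong (P W) (P-index v)) (P≡walks (suc (m ℕ.+ v))))
                                                 (s-diff n i (m₂ ℕ.+ v)))
              (rearrange (+ walks 0 m (m ℕ.+ v)) (sn i) (sq (S n (i ℕ.+ (m₂ ℕ.+ v)))))
      inner : ∀ i → outer (+ i) ≡ sn i * walkSum n i
      inner i = begin
        outer (+ i)
          ≡⟨ Σ[⋯]≡sumBelow (+ m₂) (+ n - + i) (term (+ i)) ⟩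
        sumBelow (rangeLen (+ m₂) (+ n - + i)) (λ v → term (+ i) (+ m₂ + + v))
          ≡⟨ cong (λ L → sumBelow L (λ v → term (+ i) (+ m₂ + + v)))
                  (rangeLen≡∸ (+ m₂) (+ n - + i) (suc n) (i ℕ.+ m₂)
                              (trans (shift₂ (+ n) (+ i) (+ m₂)) (ℤ.[+m]-[+n]≡m⊖n (suc n) (i ℕ.+ m₂)))) ⟩
        sumBelow (suc n ℕ.∸ (i ℕ.+ m₂)) (λ v → term (+ i) (+ m₂ + + v))
          ≡⟨ sumBelow-cong (suc n ℕ.∸ (i ℕ.+ m₂)) (λ v _ → term≡ i v) ⟩
        sumBelow (suc n ℕ.∸ (i ℕ.+ m₂)) (λ v → sn i * (+ walks 0 m (m ℕ.+ v) * sq (S n (i ℕ.+ (m₂ ℕ.+ v)))))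
          ≡⟨ sumBelow-*ˡ (suc n ℕ.∸ (i ℕ.+ m₂)) (sn i) _ ⟩
        sn i * walkSum n i ∎

    walkSum≡E : ∀ n i → i ℕ.< suc n ℕ.∸ m₂ → walkSum n i ≡ E (n ℕ.∸ i)
    walkSum≡E n i i<K with ℕ.m≤n⇒∃[o]m+o≡n (ℕ.≤-pred (m<n∸o⇒m+o<n i (suc n) m₂ i<K))
    ... | w , refl = begin
      sumBelow (suc N ℕ.∸ (i ℕ.+ m₂)) (λ v → + walks 0 m (m ℕ.+ v) * sq (S N (i ℕ.+ (m₂ ℕ.+ v))))
        ≡⟨ cong (λ L → sumBelow L (λ v → + walks 0 m (m ℕ.+ v) * sq (S N (i ℕ.+ (m₂ ℕ.+ v))))) len≡ ⟩
      sumBelow (suc w) (λ v → + walks 0 m (m ℕ.+ v) * sq (S N (i ℕ.+ (m₂ ℕ.+ v))))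
        ≡⟨ sumBelow-cong (suc w) (λ v _ → cong (λ z → + walks 0 m (m ℕ.+ v) * sq z) (S-at v)) ⟩
      sumBelow (suc w) (λ v → + walks 0 m (m ℕ.+ v) * sq (S w v))
        ≡⟨ E-as-walkSum w ⟩
      E (m₂ ℕ.+ w)
        ≡⟨ cong E (sym (trans (cong (ℕ._∸ i) (ℕ.+-assoc i m₂ w)) (ℕ.m+n∸m≡n i (m₂ ℕ.+ w)))) ⟩
      E (N ℕ.∸ i) ∎
      where
      open ≡-Reasoning
      N : ℕ
      N = i ℕ.+ m₂ ℕ.+ w
      len≡ : suc N ℕ.∸ (i ℕ.+ m₂) ≡ suc w
      len≡ = trans (cong (ℕ._∸ (i ℕ.+ m₂)) (sym (ℕ.+-suc (i ℕ.+ m₂) w))) (ℕ.m+n∸m≡n (i ℕ.+ m₂) (suc w))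
      S-at : ∀ v → S N (i ℕ.+ (m₂ ℕ.+ v)) ≡ S w v
      S-at v = trans (cong (λ z → S z (i ℕ.+ (m₂ ℕ.+ v))) (ℕ.+-assoc i m₂ w))
                     (trans (S-cancel i (m₂ ℕ.+ w) (m₂ ℕ.+ v)) (S-cancel m₂ w v))

    doubleSum≡E⋆S : ∀ n → doubleSum n ≡ E⋆S n 0
    doubleSum≡E⋆S n = begin
      doubleSum n
        ≡⟨ doubleSum≡ n ⟩
      sumBelow K (λ i → sn i * walkSum n i)
        ≡⟨ sumBelow-cong K (λ i i<K → cong (sn i *_) (walkSum≡E n i i<K)) ⟩
      sumBelow K (λ i → sn i * E (n ℕ.∸ i))
        ≡⟨ sumBelow-padZeros K (suc n ℕ.∸ K) (λ i → sn i * E (n ℕ.∸ i)) vanish ⟩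
      sumBelow (K ℕ.+ (suc n ℕ.∸ K)) (λ i → sn i * E (n ℕ.∸ i))
        ≡⟨ cong (λ L → sumBelow L (λ i → sn i * E (n ℕ.∸ i))) (ℕ.m+[n∸m]≡n (ℕ.m∸n≤m (suc n) m₂)) ⟩
      sumBelow (suc n) (λ i → sn i * E (n ℕ.∸ i))
        ≡⟨ sumBelow-cong (suc n) (λ i i<1+n → trans (ℤ.*-comm (sn i) (E (n ℕ.∸ i)))
                                                   (cong (E (n ℕ.∸ i) *_) (sym (S-n∸i i (ℕ.≤-pred i<1+n))))) ⟩
      sumBelow (suc n) (λ i → E (n ℕ.∸ i) * S n (n ℕ.∸ i))
        ≡⟨ sym (sumBelow-reverse n (λ j → E j * S n j)) ⟩
      sumBelow (suc n) (λ j → E j * S n j)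
        ≡⟨ sumBelow-cong (suc n) (λ j _ → cong (λ z → E j * S n z) (sym (ℕ.+-identityʳ j))) ⟩
      E⋆S n 0 ∎
      where
      open ≡-Reasoning
      K : ℕ
      K = suc n ℕ.∸ m₂
      vanish : ∀ i → K ℕ.≤ i → sn i * E (n ℕ.∸ i) ≡ + 0
      vanish i K≤i = trans (cong (λ z → sn i * (S (n ℕ.∸ i) 1 * z)) (S-neg (n ℕ.∸ i) m₂ n∸i<m₂))
                           (trans (cong (sn i *_) (ℤ.*-zeroʳ (S (n ℕ.∸ i) 1))) (ℤ.*-zeroʳ (sn i)))
        where
        n<i+m₂ : n ℕ.< i ℕ.+ m₂
        n<i+m₂ = ℕ.≤-trans (ℕ.m≤n+m∸n (suc n) m₂)
                           (ℕ.≤-trans (ℕ.+-monoʳ-≤ m₂ K≤i) (ℕ.≤-reflexive (ℕ.+-comm m₂ i)))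
        n∸i<m₂ : n ℕ.∸ i ℕ.< m₂
        n∸i<m₂ = ℕ.m<n+o⇒m∸n<o n i {{ℕ.>-nonZero (ℕ.≤-trans (s≤s z≤n) (ℕ.m≤n+m 2 m))}} n<i+m₂
      S-n∸i : ∀ i → i ℕ.≤ n → S n (n ℕ.∸ i) ≡ sn i
      S-n∸i i i≤n = trans (cong (λ z → S z (n ℕ.∸ i)) (sym (ℕ.m∸n+n≡m i≤n))) (S-+ (n ℕ.∸ i) i)

    sq-convolution : ∀ n → + 2 * E⋆S n 0 ≡ sq (sn n) - sn n
    sq-convolution n = trans (convolution (suc n) n 0 ℕ.≤-refl) (cong (λ z → sq z - z) (S-0 n))


open import Defs
open import Data.Nat as ℕ using (ℕ)
open import Data.Integer using (ℤ; +_; -[1+_]; _+_; _-_; _*_; _<_; ∣_∣)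
open import Data.Integer.Tactic.RingSolver using (solve-∀)
open import Data.List using (List; []; _∷_)
open import Relation.Binary.PropositionalEquality using (_≡_; cong; sym; module ≡-Reasoning)

mainTheorem8 : (m : ℕ) (s : ℤ → ℤ)
    → (∀ n → n < + 0 → s n ≡ + 0)
    → (∀ (n : ℕ) → s (+ n) ≡ δ n 0 + s (+ n - + 1) + s (+ n - + (m ℕ.+ 2)))
    → ∀ (n : ℕ) →
    s (+ n) * s (+ n) ≡ s (+ n) + + 2 * Σ[ + 0 ⋯ + n - + (m ℕ.+ 2) ] (λ k →
    Σ[ + (m ℕ.+ 2) ⋯ + n - k ] (λ r →
    + P (-[1+ 1 ] ∷ -[1+ 0 ] ∷ + m ∷ []) (∣ r - + 1 ∣)
    * s k * (s (+ n - k - r) * s (+ n - k - r))))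
mainTheorem8 m s s-neg s-rec n = begin
  s (+ n) * s (+ n)                            ≡⟨ x²≡x+[x²-x] (s (+ n)) ⟩
  s (+ n) + (s (+ n) * s (+ n) - s (+ n))      ≡⟨ cong (_+_ (s (+ n))) (sym (sq-convolution n)) ⟩
  s (+ n) + + 2 * E⋆S n 0                      ≡⟨ cong (λ x → s (+ n) + + 2 * x) (sym (doubleSum≡E⋆S n)) ⟩
  _                                            ∎
  where
  open ≡-Reasoning
  open Convolution.Recurrence m s s-neg s-rec
  x²≡x+[x²-x] : ∀ x → x * x ≡ x + (x * x - x)
  x²≡x+[x²-x] = solve-∀
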